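{- Let $D$ be a tournament anti-Sidorenko digraph. Suppose there are vertices $v,w\in V(D)$ with $(v,w),(w,v)\notin E(D)$ such that the digraphs $D'=(V(D),E(D)\cup\{(w,v)\})$ and $D''=(V(D),E(D)\cup\{(v,w)\})$ are isomorphic. Then $D'$ (equivalently $D''$) is tournament anti-Sidorenko.
   Context: All digraphs are oriented graphs (no loops, no antiparallel edges). A tournament is an orientation of a complete graph without loops. $t_D(T)=h_D(T)/v(T)^{v(D)}$ where $h_D(T)$ is the number of maps $\phi:V(D)\to V(T)$ with $(\phi(x),\phi(y))\in E(T)$ for every $(x,y)\in E(D)$. $D$ is tournament anti-Sidorenko if $t_D(T)\le2^{ -e(D)}$ for every tournament $T$; equivalently, for every tournament $T$ on $n$ vertices the number of injective such maps is at most $2^{ -e(D)}n^{v(D)}$. -}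

module Defs where

open import Data.Nat using (ℕ; zero; suc; _+_; _*_; _^_; _≤_)
open import Data.Bool using (Bool; true; false; _∧_; _∨_; not; if_then_else_; T)
open import Data.Fin using (Fin; _≟_)
open import Data.Fin.Permutation using (Permutation; _⟨$⟩ʳ_)
open import Data.Vec using (Vec; []; _∷_; lookup)
open import Data.List using (List; []; _∷_; [_]; map; concatMap; allFin)
open import Data.Nat.ListAction using (sum)
open import Data.Bool.ListAction using (and)
open import Data.Product using (_×_)
open import Relation.Binary.PropositionalEquality using (_≡_)
open import Relation.Nullary using (¬_)
open import Relation.Nullary.Decidable using (⌊_⌋)

record Digraph : Set where
  constructor mkDigraph
  field
    size : ℕ
    edge : Fin size → Fin size → Bool
open Digraph public

Oriented : Digraph → Set
Oriented D = (∀ x → ¬ T (edge D x x))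
           × (∀ x y → T (edge D x y) → ¬ T (edge D y x))

Tournament : Digraph → Set
Tournament G = Oriented G × (∀ x y → ¬ x ≡ y → T (edge G x y ∨ edge G y x))

allMaps : (k n : ℕ) → List (Vec (Fin n) k)
allMaps zero    n = [ [] ]
allMaps (suc k) n = concatMap (λ a → map (a ∷_) (allMaps k n)) (allFin n)

countB : {A : Set} → (A → Bool) → List A → ℕ
countB p xs = sum (map (λ a → if p a then 1 else 0) xs)

allPairs : (k : ℕ) → List (Fin k × Fin k)
allPairs k = concatMap (λ x → map (λ y → (x Data.Product., y)) (allFin k)) (allFin k)

e : Digraph → ℕ
e D = countB (λ p → edge D (Data.Product.proj₁ p) (Data.Product.proj₂ p)) (allPairs (size D))

isHom : (D G : Digraph) → Vec (Fin (size G)) (size D) → Bool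
isHom D G φ = and (map (λ p →
   not (edge D (Data.Product.proj₁ p) (Data.Product.proj₂ p))
   ∨ edge G (lookup φ (Data.Product.proj₁ p)) (lookup φ (Data.Product.proj₂ p)))
   (allPairs (size D)))

h : Digraph → Digraph → ℕ
h D G = countB (isHom D G) (allMaps (size D) (size G))

-- D is tournament anti-Sidorenko: t_D(T) ≤ 2^{-e(D)} for every tournament T,
-- i.e. h_D(T) · 2^{e(D)} ≤ v(T)^{v(D)}.
AntiSidorenko : Digraph → Set
AntiSidorenko D = ∀ (G : Digraph) → Tournament G →
  h D G * 2 ^ e D ≤ size G ^ size D

addEdge : (D : Digraph) → Fin (size D) → Fin (size D) → Digraph
addEdge D a b = mkDigraph (size D)
  (λ x y → edge D x y ∨ (⌊ x ≟ a ⌋ ∧ ⌊ y ≟ b ⌋))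

record _≅_ (D₁ D₂ : Digraph) : Set where
  field
    sameSize : size D₁ ≡ size D₂
    σ        : Permutation (size D₁) (size D₂)
    preserve : ∀ x y → edge D₁ x y ≡ edge D₂ (σ ⟨$⟩ʳ x) (σ ⟨$⟩ʳ y)

-- Write D′ = D + (w,v) and D″ = D + (v,w). In a tournament no map sends both (w,v) and
-- (v,w) to edges, so Hom(D′,T) and Hom(D″,T) are disjoint subsets of Hom(D,T); the
-- isomorphism D′ ≅ D″ makes them equinumerous. Hence h_{D′}(T) ≤ h_D(T)/2, while
-- e(D′) ≤ e(D) + 1, and the anti-Sidorenko bound for D transfers to D′. Only this upper
-- bound on e(D′) is needed.
module Submission where

open import Defs
open import Data.Bool using (T)
open import Data.Fin using (Fin)
open import Relation.Binary.PropositionalEquality using (_≡_)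
open import Relation.Nullary using (¬_)

open import Data.Bool using (Bool; true; false; _∧_; _∨_; not; if_then_else_)
open import Data.Bool.Properties using (T-≡; T-∨; T-∧; ⇔→≡)
open import Data.Empty using (⊥; ⊥-elim)
open import Data.Sum using (inj₁; inj₂)
open import Data.Fin.Permutation using (Permutation; _⟨$⟩ʳ_; _⟨$⟩ˡ_; inverseˡ; inverseʳ)
open import Data.List using (List; []; _∷_; map; concatMap; allFin; cartesianProductWith; _++_)
open import Data.List.Membership.Propositional using (_∈_)
open import Data.List.Properties using (map-cong; map-∘)
open import Data.List.Membership.Propositional.Properties using (∈-allFin; ∈-map⁺; ∈-cartesianProductWith⁺)
open import Data.List.Membership.Propositional.Properties.WithK using (unique∧set⇒bag)
open import Data.List.Relation.Binary.BagAndSetEquality using (∼bag⇒↭)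
open import Data.List.Relation.Binary.Permutation.Propositional using (_↭_)
import Data.List.Relation.Binary.Permutation.Propositional.Properties as ↭
open import Data.List.Relation.Unary.All as All using (All; []; _∷_)
open import Data.List.Relation.Unary.All.Properties using (all⁺; all⁻)
open import Data.List.Relation.Unary.AllPairs using ([]; _∷_)
open import Data.List.Relation.Unary.Any using (here)
open import Data.List.Relation.Unary.Unique.Propositional using (Unique)
import Data.List.Relation.Unary.Unique.Propositional.Properties as Unique
open import Data.Nat using (ℕ; zero; suc; _+_; _*_; _^_; _≤_; z≤n; s≤s)
open import Data.Nat.ListAction using (sum)
open import Data.Nat.ListAction.Properties using (sum-↭)
open import Data.Nat.Properties
open import Algebra.Properties.CommutativeSemigroup +-commutativeSemigroup using (interchange)
open import Data.Product using (_×_; _,_; proj₁; proj₂)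
open import Data.Vec using (Vec; []; _∷_; lookup; tabulate)
open import Data.Vec.Properties using (lookup∘tabulate; tabulate∘lookup; tabulate-cong)
open import Function using (_∘_; _⇔_; mk⇔; Equivalence; Inverse; _↔_; mk↔ₛ′)
import Function.Properties.Equivalence as ⇔
open import Relation.Binary.PropositionalEquality using (refl; sym; trans; cong; cong₂; subst; subst₂; module ≡-Reasoning)
open import Relation.Nullary.Decidable using (⌊_⌋; toWitness; fromWitness)
import Data.Fin as Fin

T-⇔⇒≡ : {a b : Bool} → T a ⇔ T b → a ≡ b
T-⇔⇒≡ a⇔b = ⇔→≡ (⇔.trans (⇔.sym T-≡) (⇔.trans a⇔b T-≡))

T-not-∨ : {a b : Bool} → T (not a ∨ b) ⇔ (T a → T b)
T-not-∨ {false} = mk⇔ (λ _ ()) _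
T-not-∨ {true}  = mk⇔ (λ b _ → b) (λ f → f _)

indicator : Bool → ℕ
indicator b = if b then 1 else 0

indicator-∨ : (a b : Bool) → indicator (a ∨ b) ≤ indicator a + indicator b
indicator-∨ false false = z≤n
indicator-∨ false true  = s≤s z≤n
indicator-∨ true  _     = s≤s z≤n

indicator-disjoint-⊆ : (a b c : Bool) → (T a → T c) → (T b → T c) → (T a → T b → ⊥) →
  indicator a + indicator b ≤ indicator c
indicator-disjoint-⊆ false false _    _   _   _  = z≤n
indicator-disjoint-⊆ true  true  _    _   _   ab = ⊥-elim (ab _ _)
indicator-disjoint-⊆ false true  true _   _   _  = s≤s z≤n
indicator-disjoint-⊆ true  false true _   _   _  = s≤s z≤n
indicator-disjoint-⊆ false true  false _  b⊆c _  = ⊥-elim (b⊆c _)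
indicator-disjoint-⊆ true  false false a⊆c _ _  = ⊥-elim (a⊆c _)

module _ {A : Set} where

  sum-map-+ : (f g : A → ℕ) (xs : List A) →
    sum (map f xs) + sum (map g xs) ≡ sum (map (λ a → f a + g a) xs)
  sum-map-+ f g []       = refl
  sum-map-+ f g (x ∷ xs) =
    trans (interchange (f x) _ (g x) _) (cong (f x + g x +_) (sum-map-+ f g xs))

  sum-map-mono : {f g : A → ℕ} → (∀ a → f a ≤ g a) → (xs : List A) → sum (map f xs) ≤ sum (map g xs)
  sum-map-mono f≤g []       = z≤n
  sum-map-mono f≤g (x ∷ xs) = +-mono-≤ (f≤g x) (sum-map-mono f≤g xs)

  countB-cong : {p q : A → Bool} → (∀ a → p a ≡ q a) → (xs : List A) → countB p xs ≡ countB q xs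
  countB-cong p≗q xs = cong sum (map-cong (cong indicator ∘ p≗q) xs)

  countB-map : (p : A → Bool) (f : A → A) (xs : List A) → countB p (map f xs) ≡ countB (p ∘ f) xs
  countB-map p f xs = cong sum (sym (map-∘ xs))

  countB-+-≤ : {p q r : A → Bool} →
    (∀ a → indicator (p a) + indicator (q a) ≤ indicator (r a)) →
    (xs : List A) → countB p xs + countB q xs ≤ countB r xs
  countB-+-≤ {p} {q} pq≤r xs =
    ≤-trans (≤-reflexive (sum-map-+ (indicator ∘ p) (indicator ∘ q) xs)) (sum-map-mono pq≤r xs)

  countB-≤-+ : {p q r : A → Bool} →
    (∀ a → indicator (p a) ≤ indicator (q a) + indicator (r a)) →
    (xs : List A) → countB p xs ≤ countB q xs + countB r xs
  countB-≤-+ {q = q} {r} p≤qr xs =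
    ≤-trans (sum-map-mono p≤qr xs) (≤-reflexive (sym (sum-map-+ (indicator ∘ q) (indicator ∘ r) xs)))

  countB-none : (p : A → Bool) (xs : List A) → All (¬_ ∘ T ∘ p) xs → countB p xs ≡ 0
  countB-none p []       []         = refl
  countB-none p (x ∷ xs) (¬px ∷ ¬p) with p x
  ... | true  = ⊥-elim (¬px _)
  ... | false = countB-none p xs ¬p

  countB-≤1 : (p : A → Bool) (xs : List A) → Unique xs →
    (∀ a b → T (p a) → T (p b) → a ≡ b) → countB p xs ≤ 1
  countB-≤1 p []       _          _       = z≤n
  countB-≤1 p (x ∷ xs) (x∉xs ∷ u) p-unique with p x in px
  ... | false = countB-≤1 p xs u p-unique
  ... | true  = ≤-reflexive (cong suc (countB-none p xs
      (All.map (λ x≢b pb → x≢b (p-unique x _ (subst T (sym px) _) pb)) x∉xs)))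

  countB-↔ : (p : A → Bool) (f : A ↔ A) (xs : List A) → Unique xs → (∀ a → a ∈ xs) →
    countB p xs ≡ countB (p ∘ Inverse.to f) xs
  countB-↔ p f xs u complete =
    trans (sym (sum-↭ (↭.map⁺ (indicator ∘ p) fxs↭xs))) (countB-map p to xs)
    where
    open Inverse f using (to; from; strictlyInverseˡ; strictlyInverseʳ)
    to-injective : ∀ {a b} → to a ≡ to b → a ≡ b
    to-injective {a} {b} eq = trans (sym (strictlyInverseʳ a)) (trans (cong from eq) (strictlyInverseʳ b))
    fxs↭xs : map to xs ↭ xs
    fxs↭xs = ∼bag⇒↭ (unique∧set⇒bag (Unique.map⁺ to-injective u) u (λ {a} → mk⇔
      (λ _ → complete a)
      (λ _ → subst (_∈ map to xs) (strictlyInverseˡ a) (∈-map⁺ to (complete (from a))))))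

concatMap-map≡cartesianProductWith : {A B C : Set} (f : A → B → C) (xs : List A) (ys : List B) →
  concatMap (λ x → map (f x) ys) xs ≡ cartesianProductWith f xs ys
concatMap-map≡cartesianProductWith f []       ys = refl
concatMap-map≡cartesianProductWith f (x ∷ xs) ys =
  cong (map (f x) ys ++_) (concatMap-map≡cartesianProductWith f xs ys)

∈-allPairs : (k : ℕ) (x y : Fin k) → (x , y) ∈ allPairs k
∈-allPairs k x y = subst ((x , y) ∈_) (sym (concatMap-map≡cartesianProductWith _,_ (allFin k) (allFin k)))
  (∈-cartesianProductWith⁺ _,_ (∈-allFin x) (∈-allFin y))

allPairs-unique : (k : ℕ) → Unique (allPairs k)
allPairs-unique k = subst Unique (sym (concatMap-map≡cartesianProductWith _,_ (allFin k) (allFin k)))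
  (Unique.cartesianProductWith⁺ _,_ (λ { refl → refl , refl }) (Unique.allFin⁺ k) (Unique.allFin⁺ k))

∈-allMaps : (k n : ℕ) (φ : Vec (Fin n) k) → φ ∈ allMaps k n
∈-allMaps zero    n []      = here refl
∈-allMaps (suc k) n (a ∷ φ) = subst (_ ∈_) (sym (concatMap-map≡cartesianProductWith _∷_ (allFin n) (allMaps k n)))
  (∈-cartesianProductWith⁺ _∷_ (∈-allFin a) (∈-allMaps k n φ))

allMaps-unique : (k n : ℕ) → Unique (allMaps k n)
allMaps-unique zero    n = [] ∷ []
allMaps-unique (suc k) n = subst Unique (sym (concatMap-map≡cartesianProductWith _∷_ (allFin n) (allMaps k n)))
  (Unique.cartesianProductWith⁺ _∷_ ∷-injective (Unique.allFin⁺ n) (allMaps-unique k n))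
  where
  ∷-injective : ∀ {a b : Fin n} {u w : Vec (Fin n) k} → a ∷ u ≡ b ∷ w → a ≡ b × u ≡ w
  ∷-injective refl = refl , refl

precompose : {A : Set} {k k′ : ℕ} → (Fin k → Fin k′) → Vec A k′ → Vec A k
precompose f ψ = tabulate (lookup ψ ∘ f)

precompose-inverse : {A : Set} {k k′ : ℕ} (f : Fin k → Fin k′) (g : Fin k′ → Fin k) →
  (∀ i → g (f i) ≡ i) → (φ : Vec A k) → precompose f (precompose g φ) ≡ φ
precompose-inverse f g gf φ = trans
  (tabulate-cong (λ i → trans (lookup∘tabulate (lookup φ ∘ g) _) (cong (lookup φ) (gf i))))
  (tabulate∘lookup φ)

precompose-↔ : {A : Set} {k k′ : ℕ} → Permutation k k′ → Vec A k′ ↔ Vec A k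
precompose-↔ π = mk↔ₛ′ (precompose (π ⟨$⟩ʳ_)) (precompose (π ⟨$⟩ˡ_))
  (precompose-inverse (π ⟨$⟩ʳ_) (π ⟨$⟩ˡ_) (λ _ → inverseˡ π))
  (precompose-inverse (π ⟨$⟩ˡ_) (π ⟨$⟩ʳ_) (λ _ → inverseʳ π))

IsHom : (D G : Digraph) → Vec (Fin (size G)) (size D) → Set
IsHom D G φ = ∀ x y → T (edge D x y) → T (edge G (lookup φ x) (lookup φ y))

T-isHom : (D G : Digraph) (φ : Vec (Fin (size G)) (size D)) → T (isHom D G φ) ⇔ IsHom D G φ
T-isHom D G φ = mk⇔
  (λ t x y → Equivalence.to T-not-∨ (All.lookup (all⁺ test (allPairs (size D)) t) (∈-allPairs (size D) x y)))
  (λ hom → all⁻ test {allPairs (size D)} (All.tabulate (λ {p} _ → Equivalence.from T-not-∨ (hom (proj₁ p) (proj₂ p)))))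
  where
  test : Fin (size D) × Fin (size D) → Bool
  test (x , y) = not (edge D x y) ∨ edge G (lookup φ x) (lookup φ y)

addEdge-new : (D : Digraph) (a b : Fin (size D)) → T (edge (addEdge D a b) a b)
addEdge-new D a b = Equivalence.from T-∨ (inj₂ (Equivalence.from T-∧
  (fromWitness {a? = a Fin.≟ a} refl , fromWitness {a? = b Fin.≟ b} refl)))

addEdge-old : (D : Digraph) (a b : Fin (size D)) {x y : Fin (size D)} →
  T (edge D x y) → T (edge (addEdge D a b) x y)
addEdge-old D a b exy = Equivalence.from T-∨ (inj₁ exy)

IsHom-addEdge : (D G : Digraph) (a b : Fin (size D)) (φ : Vec (Fin (size G)) (size D)) →
  IsHom (addEdge D a b) G φ → IsHom D G φ × T (edge G (lookup φ a) (lookup φ b))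
IsHom-addEdge D G a b φ hom =
  (λ x y exy → hom x y (addEdge-old D a b exy)) , hom a b (addEdge-new D a b)

IsHom-precompose : (D₁ D₂ G : Digraph) (f : Fin (size D₁) → Fin (size D₂)) →
  (∀ x y → T (edge D₁ x y) → T (edge D₂ (f x) (f y))) →
  (ψ : Vec (Fin (size G)) (size D₂)) → IsHom D₂ G ψ → IsHom D₁ G (precompose f ψ)
IsHom-precompose D₁ D₂ G f f-hom ψ hom x y exy =
  subst₂ (λ s t → T (edge G s t)) (sym (lookup∘tabulate (lookup ψ ∘ f) x)) (sym (lookup∘tabulate (lookup ψ ∘ f) y))
    (hom (f x) (f y) (f-hom x y exy))

h-cong-≅ : {D₁ D₂ : Digraph} (G : Digraph) → D₁ ≅ D₂ → h D₁ G ≡ h D₂ G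
h-cong-≅ {D₁@(mkDigraph k E₁)} {D₂@(mkDigraph k E₂)} G record { sameSize = refl ; σ = σ ; preserve = preserve } =
  begin
    h D₁ G
      ≡⟨ countB-↔ (isHom D₁ G) (precompose-↔ σ) (allMaps k n) (allMaps-unique k n) (∈-allMaps k n) ⟩
    countB (isHom D₁ G ∘ precompose (σ ⟨$⟩ʳ_)) (allMaps k n)
      ≡⟨ countB-cong isHom-pullback (allMaps k n) ⟩
    h D₂ G
  ∎
  where
  open ≡-Reasoning
  n = size G
  σ-hom : ∀ x y → T (E₁ x y) → T (E₂ (σ ⟨$⟩ʳ x) (σ ⟨$⟩ʳ y))
  σ-hom x y = subst T (preserve x y)
  σ⁻¹-hom : ∀ x y → T (E₂ x y) → T (E₁ (σ ⟨$⟩ˡ x) (σ ⟨$⟩ˡ y))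
  σ⁻¹-hom x y = subst T (sym (trans (preserve _ _) (cong₂ E₂ (inverseʳ σ) (inverseʳ σ))))
  pullback-⇔ : ∀ ψ → IsHom D₁ G (precompose (σ ⟨$⟩ʳ_) ψ) ⇔ IsHom D₂ G ψ
  pullback-⇔ ψ = mk⇔
    (λ hom → subst (IsHom D₂ G) (precompose-inverse (σ ⟨$⟩ˡ_) (σ ⟨$⟩ʳ_) (λ _ → inverseʳ σ) ψ)
      (IsHom-precompose D₂ D₁ G (σ ⟨$⟩ˡ_) σ⁻¹-hom (precompose (σ ⟨$⟩ʳ_) ψ) hom))
    (IsHom-precompose D₁ D₂ G (σ ⟨$⟩ʳ_) σ-hom ψ)
  isHom-pullback : ∀ ψ → isHom D₁ G (precompose (σ ⟨$⟩ʳ_) ψ) ≡ isHom D₂ G ψ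
  isHom-pullback ψ = T-⇔⇒≡ (⇔.trans (T-isHom D₁ G (precompose (σ ⟨$⟩ʳ_) ψ))
    (⇔.trans (pullback-⇔ ψ) (⇔.sym (T-isHom D₂ G ψ))))

h-addEdge-antiparallel : (D G : Digraph) → Oriented G → (a b : Fin (size D)) →
  h (addEdge D a b) G + h (addEdge D b a) G ≤ h D G
h-addEdge-antiparallel D G oriented a b = countB-+-≤ (λ φ → indicator-disjoint-⊆ _ _ _
    (restrict a b φ) (restrict b a φ)
    (λ ab ba → proj₂ oriented _ _ (new a b φ ab) (new b a φ ba)))
  (allMaps (size D) (size G))
  where
  split : ∀ a b φ → T (isHom (addEdge D a b) G φ) → IsHom D G φ × T (edge G (lookup φ a) (lookup φ b))
  split a b φ t = IsHom-addEdge D G a b φ (Equivalence.to (T-isHom (addEdge D a b) G φ) t)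
  restrict : ∀ a b φ → T (isHom (addEdge D a b) G φ) → T (isHom D G φ)
  restrict a b φ t = Equivalence.from (T-isHom D G φ) (proj₁ (split a b φ t))
  new : ∀ a b φ → T (isHom (addEdge D a b) G φ) → T (edge G (lookup φ a) (lookup φ b))
  new a b φ t = proj₂ (split a b φ t)

e-addEdge : (D : Digraph) (a b : Fin (size D)) → e (addEdge D a b) ≤ suc (e D)
e-addEdge D a b = begin
    e (addEdge D a b)
      ≤⟨ countB-≤-+ (λ p → indicator-∨ (edge D (proj₁ p) (proj₂ p)) (isAB p)) (allPairs (size D)) ⟩
    e D + countB isAB (allPairs (size D))
      ≤⟨ +-monoʳ-≤ (e D) (countB-≤1 isAB (allPairs (size D)) (allPairs-unique (size D))
           (λ p q tp tq → trans (isAB-sound p tp) (sym (isAB-sound q tq)))) ⟩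
    e D + 1
      ≡⟨ +-comm (e D) 1 ⟩
    suc (e D) ∎
  where
  open ≤-Reasoning
  isAB : Fin (size D) × Fin (size D) → Bool
  isAB (x , y) = ⌊ x Fin.≟ a ⌋ ∧ ⌊ y Fin.≟ b ⌋
  isAB-sound : ∀ p → T (isAB p) → p ≡ (a , b)
  isAB-sound (x , y) t = let x≡a , y≡b = Equivalence.to (T-∧ {⌊ x Fin.≟ a ⌋}) t
    in cong₂ _,_ (toWitness {a? = x Fin.≟ a} x≡a) (toWitness {a? = y Fin.≟ b} y≡b)

proposition3p12 : (D : Digraph) → Oriented D → AntiSidorenko D →
    (v w : Fin (size D)) → ¬ v ≡ w →
    ¬ T (edge D v w) → ¬ T (edge D w v) →
    addEdge D w v ≅ addEdge D v w →
    AntiSidorenko (addEdge D w v)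
proposition3p12 D _ anti v w _ _ _ D′≅D″ G tournament = begin
    h′ * 2 ^ e D′
      ≤⟨ *-monoʳ-≤ h′ (^-monoʳ-≤ 2 (e-addEdge D w v)) ⟩
    h′ * (2 * 2 ^ e D)
      ≡⟨ sym (*-assoc h′ 2 (2 ^ e D)) ⟩
    (h′ * 2) * 2 ^ e D
      ≡⟨ cong (_* 2 ^ e D) (trans (*-comm h′ 2) (cong (h′ +_) (trans (+-identityʳ h′) (h-cong-≅ G D′≅D″)))) ⟩
    (h′ + h (addEdge D v w) G) * 2 ^ e D
      ≤⟨ *-monoˡ-≤ (2 ^ e D) (h-addEdge-antiparallel D G (proj₁ tournament) w v) ⟩
    h D G * 2 ^ e D
      ≤⟨ anti G tournament ⟩
    size G ^ size D ∎
  where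
  open ≤-Reasoning
  D′ = addEdge D w v
  h′ = h D′ G
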